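{- Let $q$ be an odd prime power, $\mathbb{F}=\mathbb{F}_q$, and $(x,y)\in S$. Then $(x,y)\in S_{00}^{01}$ if and only if $-xy-y+x$ and $(-x^2y+x^2+y^2-xy)(x-y)$ are nonzero squares and $(1-y)(x-y)$ is a nonsquare.
   Context: A square is an element $z^2$, $z\in\mathbb{F}$; a nonsquare is an element that is not a square. $\Sigma$ is the set of $(a,b)\in\mathbb{F}^2$ with $a\ne b$, $a,b\notin\{0,1\}$ and $ab$, $(1-a)(1-b)$ squares. $S$ is the set of $(x,y)\in\mathbb{F}^2$ with $x,y$ squares, $x\ne y$, $\{x,y\}\cap\{0,1\}=\emptyset$. $\Psi:\Sigma\to S$ is $\Psi(a,b)=(a/b,(1-a)/(1-b))$. For $(a,b)\in\Sigma$ let $\psi=\psi_{a,b}$, $\psi(u)=au$ if $u$ is a square and $\psi(u)=bu$ if $u$ is a nonsquare. Let $E(a,b)$ be the set of $(u,v)\in\mathbb{F}^2\setminus\{(0,0)\}$ with $\psi(\psi(u)-v)=\psi(-v)+\psi(u-v-\psi(-v))$. For $i,j,r,s\in\{0,1\}$, $E_{ij}^{rs}(a,b)$ is the set of $(u,v)\in E(a,b)$ such that: $i=0$ iff $u$ is a square; $j=0$ iff $-v$ is a square; $r=0$ iff $\psi(u)-v$ is a square; $s=0$ iff $u-v-\psi(-v)$ is a square. $\Sigma_{ij}^{rs}=\{(a,b)\in\Sigma:E_{ij}^{rs}(a,b)\ne\emptyset\}$ and $S_{ij}^{rs}=\Psi(\Sigma_{ij}^{rs})$. -}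

module Defs where

open import Data.Nat using (ℕ; suc; _^_)
open import Data.Nat.Primality using (Prime)
open import Data.Fin using (Fin; zero; suc)
import Data.Fin as Fin
import Data.Fin.Properties as FinP
open import Data.Product using (Σ; ∃; ∃-syntax; _×_; _,_)
open import Data.Empty using (⊥)
open import Function.Bundles using (_↔_; Inverse)
open import Relation.Nullary using (¬_; Dec; yes; no)
open import Relation.Binary.PropositionalEquality
  using (_≡_; _≢_; refl; sym; trans; cong)
open import Algebra.Structures using (IsCommutativeRing)

IsPrimePower : ℕ → Set
IsPrimePower q = ∃[ p ] ∃[ k ] (Prime p × q ≡ p ^ suc k)

-- A finite field: a commutative ring (propositional equality) with 0 ≠ 1,
-- multiplicative inverses of nonzero elements, and a bijection with Fin card.
-- (The value of 0⁻¹ is irrelevant/unspecified.)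
record FiniteField : Set₁ where
  infixl 6 _+_ _-_
  infixl 7 _*_
  infix 8 -_
  field
    Carrier : Set
    _+_ _*_ : Carrier → Carrier → Carrier
    -_ : Carrier → Carrier
    0# 1# : Carrier
    isCommutativeRing : IsCommutativeRing _≡_ _+_ _*_ -_ 0# 1#
    0≢1 : 0# ≢ 1#
    _⁻¹ : Carrier → Carrier
    inverse : ∀ x → x ≢ 0# → x * (x ⁻¹) ≡ 1#
    card : ℕ
    enum : Carrier ↔ Fin card

  _-_ : Carrier → Carrier → Carrier
  x - y = x + (- y)

  _/_ : Carrier → Carrier → Carrier
  x / y = x * (y ⁻¹)

  IsSquare : Carrier → Set
  IsSquare u = ∃[ z ] (z * z ≡ u)

  private
    module E = Inverse enum

  _≟_ : (x y : Carrier) → Dec (x ≡ y)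
  x ≟ y with E.to x Fin.≟ E.to y
  ... | yes p = yes (trans (sym (E.strictlyInverseʳ x))
                      (trans (cong E.from p) (E.strictlyInverseʳ y)))
  ... | no ¬p = no (λ e → ¬p (cong E.to e))

  isSquare? : (u : Carrier) → Dec (IsSquare u)
  isSquare? u with FinP.any? {P = λ i → E.from i * E.from i ≡ u} (λ i → (E.from i * E.from i) ≟ u)
  ... | yes (i , p) = yes (E.from i , p)
  ... | no ¬p = no (λ { (z , e) → ¬p (E.to z , subst2 z e) })
    where
    subst2 : ∀ z → z * z ≡ u → E.from (E.to z) * E.from (E.to z) ≡ u
    subst2 z e rewrite E.strictlyInverseʳ z = e

  InΣ : Carrier → Carrier → Set
  InΣ a b = a ≢ b × a ≢ 0# × a ≢ 1# × b ≢ 0# × b ≢ 1#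
          × IsSquare (a * b) × IsSquare ((1# - a) * (1# - b))

  InS : Carrier → Carrier → Set
  InS x y = IsSquare x × IsSquare y × x ≢ y
          × x ≢ 0# × x ≢ 1# × y ≢ 0# × y ≢ 1#

  Ψ : Carrier → Carrier → Carrier × Carrier
  Ψ a b = (a / b , (1# - a) / (1# - b))

  ψ : Carrier → Carrier → Carrier → Carrier
  ψ a b u with isSquare? u
  ... | yes _ = a * u
  ... | no _  = b * u

  InE : Carrier → Carrier → Carrier → Carrier → Set
  InE a b u v = ¬ (u ≡ 0# × v ≡ 0#)
              × ψ a b (ψ a b u - v) ≡ ψ a b (- v) + ψ a b (u - v - ψ a b (- v))

  SqClass : Fin 2 → Carrier → Set
  SqClass zero u = IsSquare u
  SqClass (suc _) u = ¬ IsSquare u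

  InE' : (i j r s : Fin 2) → Carrier → Carrier → Carrier → Carrier → Set
  InE' i j r s a b u v = InE a b u v × SqClass i u × SqClass j (- v)
                       × SqClass r (ψ a b u - v) × SqClass s (u - v - ψ a b (- v))

  InΣ' : (i j r s : Fin 2) → Carrier → Carrier → Set
  InΣ' i j r s a b = InΣ a b × ∃[ u ] ∃[ v ] InE' i j r s a b u v

  InS' : (i j r s : Fin 2) → Carrier → Carrier → Set
  InS' i j r s x y = ∃[ a ] ∃[ b ] (InΣ' i j r s a b × Ψ a b ≡ (x , y))

  NonzeroSquare : Carrier → Set
  NonzeroSquare w = IsSquare w × w ≢ 0#

-- Ψ(a , b) = (x , y) forces a = x b and b (x - y) = 1 - y.  For (u , v) in
-- E₀₀⁰¹(a , b) each ψ acts by a known scalar, and modulo that relation the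
-- equation of E becomes b (1 - b) (u A - y w) = 0, with w = - v and
-- A = x - y - x y; so u A = y w.  This makes A a square, and two further
-- identities, (x - y)² A P = w Q (x - y) and A b T = w y (x b)², give the
-- square classes of P = a u + w and T = u + w - a w: P has the class of
-- Q (x - y), and T that of b, which is that of (1 - y) (x - y) because
-- b (1 - y) (x - y) = (1 - y)².  Conversely b = (1 - y) / (x - y), u = y A and
-- w = A² give a point of E₀₀⁰¹(x b , b) exactly when the conditions hold.

module Submission where

open import Defs
open import Data.Nat.Divisibility using (_∣_)
open import Data.Fin using (zero; suc)
open import Data.Product using (_×_)
open import Relation.Nullary using (¬_)
open import Function.Bundles using (_⇔_)

open import Algebra.Bundles using (CommutativeRing)
open import Data.Product using (_,_; proj₁; proj₂)
open import Function.Base using (_∘_)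
open import Function.Bundles using (mk⇔; Equivalence)
import Function.Properties.Equivalence as ⇔
open import Relation.Nullary using (yes; no; contraposition; contradiction)

-- The solver of Algebra.Solver.Ring needs a coefficient ring with decidable
-- equality; ℤ, mapped into R by its canonical homomorphism, serves for every R.
module IntegerCoefficients {c ℓ} (R : CommutativeRing c ℓ) where
  open CommutativeRing R
  open import Algebra.Solver.Ring.AlmostCommutativeRing
    using (_-Raw-AlmostCommutative⟶_; fromCommutativeRing)
  open import Data.Integer as ℤ using (ℤ; +_; -[1+_]; _⊖_)
  import Data.Integer.Properties as ℤ
  open import Data.Maybe using (Maybe; just; nothing)
  open import Data.Nat as ℕ using (zero; suc)
  import Data.Nat.Properties as ℕ
  open import Data.Sign as Sign using (Sign)
  open import Relation.Binary.PropositionalEquality using (cong)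
  open import Algebra.Properties.Ring ring
    using (-‿involutive; -0#≈0#; -‿distribˡ-*; -‿distribʳ-*; -‿+-comm)
  open import Algebra.Properties.CommutativeSemigroup +-commutativeSemigroup
    using (interchange)
  open import Algebra.Properties.Semiring.Mult.TCOptimised semiring
    using (1+×; ×-homo-+; ×1-homo-*) renaming (_×_ to _×′_)
  open import Relation.Binary.Reasoning.Setoid setoid

  private
    fromℤ : ℤ → Carrier
    fromℤ (+ n)    = n ×′ 1#
    fromℤ -[1+ n ] = - (suc n ×′ 1#)

    signed : Sign → Carrier → Carrier
    signed Sign.+ x = x
    signed Sign.- x = - x

    signed-cong : ∀ s {x y} → x ≈ y → signed s x ≈ signed s y
    signed-cong Sign.+ x≈y = x≈y
    signed-cong Sign.- x≈y = -‿cong x≈y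

    signed-* : ∀ s t x y → signed (s Sign.* t) (x * y) ≈ signed s x * signed t y
    signed-* Sign.+ Sign.+ x y = refl
    signed-* Sign.+ Sign.- x y = -‿distribʳ-* x y
    signed-* Sign.- Sign.+ x y = -‿distribˡ-* x y
    signed-* Sign.- Sign.- x y = begin
      x * y        ≈⟨ -‿involutive (x * y) ⟨
      - - (x * y)  ≈⟨ -‿cong (-‿distribʳ-* x y) ⟩
      - (x * - y)  ≈⟨ -‿distribˡ-* x (- y) ⟩
      - x * - y    ∎

    fromℤ-◃ : ∀ s n → fromℤ (s ℤ.◃ n) ≈ signed s (n ×′ 1#)
    fromℤ-◃ Sign.+ zero    = refl
    fromℤ-◃ Sign.- zero    = sym -0#≈0#
    fromℤ-◃ Sign.+ (suc n) = refl
    fromℤ-◃ Sign.- (suc n) = refl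

    fromℤ-signed : ∀ i → fromℤ i ≈ signed (ℤ.sign i) (ℤ.∣ i ∣ ×′ 1#)
    fromℤ-signed (+ zero)  = refl
    fromℤ-signed (+ suc n) = refl
    fromℤ-signed -[1+ n ]  = refl

    fromℤ-⊖ : ∀ m n → fromℤ (m ⊖ n) ≈ m ×′ 1# - n ×′ 1#
    fromℤ-⊖ zero    zero    = sym (-‿inverseʳ 0#)
    fromℤ-⊖ (suc m) zero    = sym (trans (+-congˡ -0#≈0#) (+-identityʳ _))
    fromℤ-⊖ zero    (suc n) = sym (+-identityˡ _)
    fromℤ-⊖ (suc m) (suc n) = begin
      fromℤ (suc m ⊖ suc n)        ≡⟨ cong fromℤ (ℤ.[1+m]⊖[1+n]≡m⊖n m n) ⟩
      fromℤ (m ⊖ n)                ≈⟨ fromℤ-⊖ m n ⟩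
      M - N                        ≈⟨ +-identityˡ (M - N) ⟨
      0# + (M - N)                 ≈⟨ +-congʳ (-‿inverseʳ 1#) ⟨
      (1# - 1#) + (M - N)          ≈⟨ interchange 1# (- 1#) M (- N) ⟩
      (1# + M) + (- 1# - N)        ≈⟨ +-congˡ (-‿+-comm 1# N) ⟩
      (1# + M) - (1# + N)          ≈⟨ +-cong (1+× m 1#) (-‿cong (1+× n 1#)) ⟨
      suc m ×′ 1# - suc n ×′ 1#    ∎
      where M = m ×′ 1#; N = n ×′ 1#

    fromℤ-+ : ∀ i j → fromℤ (i ℤ.+ j) ≈ fromℤ i + fromℤ j
    fromℤ-+ (+ m)    (+ n)    = ×-homo-+ 1# m n
    fromℤ-+ (+ m)    -[1+ n ] = fromℤ-⊖ m (suc n)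
    fromℤ-+ -[1+ m ] (+ n)    = trans (fromℤ-⊖ n (suc m)) (+-comm _ _)
    fromℤ-+ -[1+ m ] -[1+ n ] = begin
      - (suc (suc (m ℕ.+ n)) ×′ 1#)    ≡⟨ cong (λ k → - (suc k ×′ 1#)) (ℕ.+-suc m n) ⟨
      - ((suc m ℕ.+ suc n) ×′ 1#)      ≈⟨ -‿cong (×-homo-+ 1# (suc m) (suc n)) ⟩
      - (suc m ×′ 1# + suc n ×′ 1#)    ≈⟨ -‿+-comm _ _ ⟨
      - (suc m ×′ 1#) - suc n ×′ 1#    ∎

    fromℤ-* : ∀ i j → fromℤ (i ℤ.* j) ≈ fromℤ i * fromℤ j
    fromℤ-* i j = begin
      fromℤ (s ℤ.◃ ∣i∣ ℕ.* ∣j∣)                     ≈⟨ fromℤ-◃ s (∣i∣ ℕ.* ∣j∣) ⟩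
      signed s ((∣i∣ ℕ.* ∣j∣) ×′ 1#)                ≈⟨ signed-cong s (×1-homo-* ∣i∣ ∣j∣) ⟩
      signed s ((∣i∣ ×′ 1#) * (∣j∣ ×′ 1#))          ≈⟨ signed-* (ℤ.sign i) (ℤ.sign j) _ _ ⟩
      signed (ℤ.sign i) (∣i∣ ×′ 1#) * signed (ℤ.sign j) (∣j∣ ×′ 1#)
                                                    ≈⟨ *-cong (fromℤ-signed i) (fromℤ-signed j) ⟨
      fromℤ i * fromℤ j                             ∎
      where
      s = ℤ.sign i Sign.* ℤ.sign j
      ∣i∣ = ℤ.∣ i ∣
      ∣j∣ = ℤ.∣ j ∣

    fromℤ-neg : ∀ i → fromℤ (ℤ.- i) ≈ - fromℤ i
    fromℤ-neg -[1+ n ]  = sym (-‿involutive _)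
    fromℤ-neg (+ zero)  = sym -0#≈0#
    fromℤ-neg (+ suc n) = refl

    fromℤ-homomorphism : ℤ.+-*-rawRing -Raw-AlmostCommutative⟶ fromCommutativeRing R
    fromℤ-homomorphism = record
      { ⟦_⟧    = fromℤ
      ; +-homo = fromℤ-+
      ; *-homo = fromℤ-*
      ; -‿homo = fromℤ-neg
      ; 0-homo = refl
      ; 1-homo = refl
      }

    fromℤ-≟ : ∀ i j → Maybe (fromℤ i ≈ fromℤ j)
    fromℤ-≟ i j with i ℤ.≟ j
    ... | yes i≡j = just (reflexive (cong fromℤ i≡j))
    ... | no _    = nothing

  open import Algebra.Solver.Ring ℤ.+-*-rawRing (fromCommutativeRing R) fromℤ-homomorphism fromℤ-≟ public

  0ₚ 1ₚ : ∀ {n} → Polynomial n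
  0ₚ = con ℤ.0ℤ
  1ₚ = con ℤ.1ℤ

open import Relation.Binary.PropositionalEquality
  using (_≡_; _≢_; refl; sym; trans; cong; cong₂; subst; module ≡-Reasoning)

module FiniteFieldProperties (F : FiniteField) where
  open FiniteField F public

  commutativeRing : CommutativeRing _ _
  commutativeRing = record { isCommutativeRing = isCommutativeRing }

  open CommutativeRing commutativeRing public using (+-identityˡ; *-comm; zeroʳ; ring)
  open import Algebra.Properties.Ring ring public using (-‿involutive)
  open IntegerCoefficients commutativeRing public
  open ≡-Reasoning

  x-y≡0⇒x≡y : ∀ {x y} → x - y ≡ 0# → x ≡ y
  x-y≡0⇒x≡y {x} {y} x-y≡0 = begin
    x            ≡⟨ solve 2 (λ x y → x := (x :- y) :+ y) refl x y ⟩
    (x - y) + y  ≡⟨ cong (_+ y) x-y≡0 ⟩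
    0# + y       ≡⟨ +-identityˡ y ⟩
    y            ∎

  x≢y⇒x-y≢0 : ∀ {x y} → x ≢ y → x - y ≢ 0#
  x≢y⇒x-y≢0 = contraposition x-y≡0⇒x≡y

  *-cancelˡ-≡ : ∀ {c s t} → c ≢ 0# → c * s ≡ c * t → s ≡ t
  *-cancelˡ-≡ {c} {s} {t} c≢0 cs≡ct = begin
    s                  ≡⟨ c⁻¹*[c*r]≡r s ⟨
    c ⁻¹ * (c * s)     ≡⟨ cong (c ⁻¹ *_) cs≡ct ⟩
    c ⁻¹ * (c * t)     ≡⟨ c⁻¹*[c*r]≡r t ⟩
    t                  ∎
    where
    c⁻¹*[c*r]≡r : ∀ r → c ⁻¹ * (c * r) ≡ r
    c⁻¹*[c*r]≡r r = begin
      c ⁻¹ * (c * r)   ≡⟨ solve 3 (λ c c⁻¹ r → c⁻¹ :* (c :* r) := (c :* c⁻¹) :* r) refl c (c ⁻¹) r ⟩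
      (c * c ⁻¹) * r   ≡⟨ cong (_* r) (inverse c c≢0) ⟩
      1# * r           ≡⟨ solve 1 (λ r → 1ₚ :* r := r) refl r ⟩
      r                ∎

  *-≢0 : ∀ {s t} → s ≢ 0# → t ≢ 0# → s * t ≢ 0#
  *-≢0 {s} s≢0 t≢0 st≡0 = t≢0 (*-cancelˡ-≡ s≢0 (trans st≡0 (sym (zeroʳ s))))

  -1≢0 : - 1# ≢ 0#
  -1≢0 -1≡0 = 0≢1 (sym (begin
    1#      ≡⟨ -‿involutive 1# ⟨
    - - 1#  ≡⟨ cong -_ -1≡0 ⟩
    - 0#    ≡⟨ solve 0 (:- 0ₚ := 0ₚ) refl ⟩
    0#      ∎))

  p/q*q≡p : ∀ {p q} → q ≢ 0# → (p / q) * q ≡ p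
  p/q*q≡p {p} {q} q≢0 = begin
    (p * q ⁻¹) * q    ≡⟨ solve 3 (λ p q q⁻¹ → (p :* q⁻¹) :* q := p :* (q :* q⁻¹)) refl p q (q ⁻¹) ⟩
    p * (q * q ⁻¹)    ≡⟨ cong (p *_) (inverse q q≢0) ⟩
    p * 1#            ≡⟨ solve 1 (λ p → p :* 1ₚ := p) refl p ⟩
    p                 ∎

  p*q/q≡p : ∀ {p q} → q ≢ 0# → (p * q) / q ≡ p
  p*q/q≡p {p} {q} q≢0 = begin
    (p * q) * q ⁻¹    ≡⟨ solve 3 (λ p q q⁻¹ → (p :* q) :* q⁻¹ := p :* (q :* q⁻¹)) refl p q (q ⁻¹) ⟩
    p * (q * q ⁻¹)    ≡⟨ cong (p *_) (inverse q q≢0) ⟩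
    p * 1#            ≡⟨ solve 1 (λ p → p :* 1ₚ := p) refl p ⟩
    p                 ∎

  p/q≡r⇒p≡r*q : ∀ {p q r} → q ≢ 0# → p / q ≡ r → p ≡ r * q
  p/q≡r⇒p≡r*q q≢0 p/q≡r = trans (sym (p/q*q≡p q≢0)) (cong (_* _) p/q≡r)

  ≡⇔≡-scaled : ∀ {k p q r s} → k ≢ 0# → p - q ≡ k * (r - s) → (p ≡ q ⇔ r ≡ s)
  ≡⇔≡-scaled {k} {p} {q} {r} {s} k≢0 p-q≡k[r-s] = mk⇔ to from
    where
    to : p ≡ q → r ≡ s
    to refl = x-y≡0⇒x≡y (*-cancelˡ-≡ k≢0 (begin
      k * (r - s)  ≡⟨ p-q≡k[r-s] ⟨
      p - p        ≡⟨ solve 2 (λ p k → p :- p := k :* 0ₚ) refl p k ⟩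
      k * 0#       ∎))
    from : r ≡ s → p ≡ q
    from refl = x-y≡0⇒x≡y (begin
      p - q        ≡⟨ p-q≡k[r-s] ⟩
      k * (r - r)  ≡⟨ solve 2 (λ k r → k :* (r :- r) := 0ₚ) refl k r ⟩
      0#           ∎)

  modulo₁ : ∀ {L R p q} k → p ≡ q → L ≡ R + k * (p - q) → L ≡ R
  modulo₁ {R = R} {p} k refl L≡ = trans L≡ (solve 3 (λ R k p → R :+ k :* (p :- p) := R) refl R k p)

  modulo₂ : ∀ {L R p q p′ q′} k k′ → p ≡ q → p′ ≡ q′ →
            L ≡ R + k * (p - q) + k′ * (p′ - q′) → L ≡ R
  modulo₂ {R = R} {p} {p′ = p′} k k′ refl refl L≡ =
    trans L≡ (solve 5 (λ R k p k′ p′ → R :+ k :* (p :- p) :+ k′ :* (p′ :- p′) := R) refl R k p k′ p′)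

  square-* : ∀ {s t} → IsSquare s → IsSquare t → IsSquare (s * t)
  square-* (z , refl) (z′ , refl) =
    z * z′ , solve 2 (λ z z′ → (z :* z′) :* (z :* z′) := (z :* z) :* (z′ :* z′)) refl z z′

  square-cancelˡ : ∀ {s t} → NonzeroSquare s → IsSquare (s * t) → IsSquare t
  square-cancelˡ {t = t} ((z , refl) , s≢0) (z′ , z′²≡st) = z′ * z ⁻¹ , *-cancelˡ-≡ s≢0 (begin
    (z * z) * ((z′ * z ⁻¹) * (z′ * z ⁻¹))  ≡⟨ solve 3 (λ z z′ z⁻¹ → (z :* z) :* ((z′ :* z⁻¹) :* (z′ :* z⁻¹))
                                                    := (z′ :* z′) :* ((z :* z⁻¹) :* (z :* z⁻¹))) refl z z′ (z ⁻¹) ⟩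
    (z′ * z′) * ((z * z ⁻¹) * (z * z ⁻¹))  ≡⟨ cong₂ (λ u v → u * (v * v)) z′²≡st (inverse z z≢0) ⟩
    ((z * z) * t) * (1# * 1#)              ≡⟨ solve 2 (λ z t → ((z :* z) :* t) :* (1ₚ :* 1ₚ) := (z :* z) :* t) refl z t ⟩
    (z * z) * t                            ∎)
    where
    z≢0 : z ≢ 0#
    z≢0 refl = s≢0 (zeroʳ 0#)

  square-⇔ : ∀ {s t p q} → NonzeroSquare s → NonzeroSquare t → s * p ≡ t * q →
             IsSquare p ⇔ IsSquare q
  square-⇔ s□ t□ sp≡tq = mk⇔
    (λ p□ → square-cancelˡ t□ (subst IsSquare sp≡tq (square-* (proj₁ s□) p□)))
    (λ q□ → square-cancelˡ s□ (subst IsSquare (sym sp≡tq) (square-* (proj₁ t□) q□)))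

  square-factors-⇔ : ∀ {s t} → NonzeroSquare (s * t) → IsSquare s ⇔ IsSquare t
  square-factors-⇔ {s} {t} (st□ , st≢0) = mk⇔
    (λ s□ → square-cancelˡ (s□ , λ { refl → st≢0 (solve 1 (λ t → 0ₚ :* t := 0ₚ) refl t) }) st□)
    (λ t□ → square-cancelˡ (t□ , λ { refl → st≢0 (zeroʳ s) }) (subst IsSquare (*-comm s t) st□))

  ψ-square : ∀ a b {u} → IsSquare u → ψ a b u ≡ a * u
  ψ-square a b {u} u□ with isSquare? u
  ... | yes _  = refl
  ... | no u∉□ = contradiction u□ u∉□

  ψ-nonsquare : ∀ a b {u} → ¬ IsSquare u → ψ a b u ≡ b * u
  ψ-nonsquare a b {u} u∉□ with isSquare? u
  ... | yes u□ = contradiction u□ u∉□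
  ... | no _   = refl

  E₀₀⁰¹ : (a b u w : Carrier) → Set
  E₀₀⁰¹ a b u w = IsSquare u × IsSquare w × IsSquare (a * u + w) × ¬ IsSquare (u + w - a * w)
                × a * (a * u + w) ≡ a * w + b * (u + w - a * w)

  E₀₀⁰¹⇒w≢0 : ∀ {a b u w} → E₀₀⁰¹ a b u w → w ≢ 0#
  E₀₀⁰¹⇒w≢0 {a} {u = u} (u□ , _ , _ , T∉□ , _) refl =
    T∉□ (subst IsSquare (solve 2 (λ a u → u := u :+ 0ₚ :- a :* 0ₚ) refl a u) u□)

  InE′⇔E₀₀⁰¹ : ∀ {a b u v} → InE' zero zero zero (suc zero) a b u v ⇔ E₀₀⁰¹ a b u (- v)
  InE′⇔E₀₀⁰¹ {a} {b} {u} {v} = mk⇔ to from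
    where
    to : InE' zero zero zero (suc zero) a b u v → E₀₀⁰¹ a b u (- v)
    to ((_ , eq) , u□ , w□ , P□ , T∉□)
      with ψ a b u | ψ-square a b u□ | ψ a b (- v) | ψ-square a b w□
    ... | _ | refl | _ | refl =
      u□ , w□ , P□ , T∉□ , trans (sym (ψ-square a b P□)) (trans eq (cong ((a * - v) +_) (ψ-nonsquare a b T∉□)))
    from : E₀₀⁰¹ a b u (- v) → InE' zero zero zero (suc zero) a b u v
    from E@(u□ , w□ , P□ , T∉□ , eq)
      with ψ a b u | ψ-square a b u□ | ψ a b (- v) | ψ-square a b w□
    ... | _ | refl | _ | refl =
      (uv≢0 , trans (ψ-square a b P□) (trans eq (cong ((a * - v) +_) (sym (ψ-nonsquare a b T∉□))))) ,
      u□ , w□ , P□ , T∉□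
      where
      uv≢0 : ¬ (u ≡ 0# × v ≡ 0#)
      uv≢0 (_ , refl) = E₀₀⁰¹⇒w≢0 E (solve 0 (:- 0ₚ := 0ₚ) refl)

module AtPoint (F : FiniteField) (x y : FiniteField.Carrier F) where
  open FiniteFieldProperties F
  open ≡-Reasoning

  A Q D C : Carrier
  A = - (x * y) - y + x
  Q = - (x * x * y) + x * x + y * y - x * y
  D = x - y
  C = (1# - y) * D

  Conditions : Set
  Conditions = NonzeroSquare A × NonzeroSquare (Q * D) × ¬ IsSquare C

  Fibre : Carrier → Set
  Fibre b = b * D ≡ 1# - y

  private
    Aₚ Qₚ Dₚ Cₚ : ∀ {n} → Polynomial n → Polynomial n → Polynomial n
    Aₚ x y = :- (x :* y) :- y :+ x
    Qₚ x y = :- (x :* x :* y) :+ x :* x :+ y :* y :- x :* y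
    Dₚ x y = x :- y
    Cₚ x y = (1ₚ :- y) :* Dₚ x y

    fibreₚ : ∀ {n} → Polynomial n → Polynomial n → Polynomial n → Polynomial n
    fibreₚ x y b = b :* Dₚ x y :- (1ₚ :- y)

  Ψ₂-identity : ∀ b → (1# - x * b) - y * (1# - b) ≡ - 1# * (b * D - (1# - y))
  Ψ₂-identity b =
    solve 3 (λ x y b → (1ₚ :- x :* b) :- y :* (1ₚ :- b) := :- 1ₚ :* fibreₚ x y b) refl x y b

  D*[1-b]≡x-1 : ∀ {b} → Fibre b → D * (1# - b) ≡ x - 1#
  D*[1-b]≡x-1 {b} fib = modulo₁ (- 1#) fib
    (solve 3 (λ x y b → Dₚ x y :* (1ₚ :- b) := (x :- 1ₚ) :+ (:- 1ₚ) :* fibreₚ x y b) refl x y b)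

  equation-identity : ∀ {b} u w → Fibre b →
    (x * b) * ((x * b) * u + w) - ((x * b) * w + b * (u + w - (x * b) * w))
      ≡ (b * (1# - b)) * (u * A - y * w)
  equation-identity {b} u w fib = modulo₁ (b * u + b * u * x + b * w) fib
    (solve 5 (λ x y b u w →
        (x :* b) :* ((x :* b) :* u :+ w) :- ((x :* b) :* w :+ b :* (u :+ w :- (x :* b) :* w))
          := (b :* (1ₚ :- b)) :* (u :* Aₚ x y :- y :* w)
             :+ (b :* u :+ b :* u :* x :+ b :* w) :* fibreₚ x y b)
      refl x y b u w)

  T-identity : ∀ {b u w} → Fibre b → u * A ≡ y * w →
    A * (b * (u + w - (x * b) * w)) ≡ (w * y) * ((x * b) * (x * b))
  T-identity {b} {u} {w} fib uA≡yw = modulo₂ b (- (b * w * x)) uA≡yw fib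
    (solve 5 (λ x y b u w →
        Aₚ x y :* (b :* (u :+ w :- (x :* b) :* w))
          := (w :* y) :* ((x :* b) :* (x :* b)) :+ b :* (u :* Aₚ x y :- y :* w)
             :+ (:- (b :* w :* x)) :* fibreₚ x y b)
      refl x y b u w)

  P-identity : ∀ {b u w} → Fibre b → u * A ≡ y * w →
    (D * D * A) * ((x * b) * u + w) ≡ w * (Q * D)
  P-identity {b} {u} {w} fib uA≡yw =
    modulo₂ (b * x * x * x - (1# + 1#) * b * x * x * y + b * x * y * y)
            (w * x * x * y - w * x * y * y) uA≡yw fib
    (solve 5 (λ x y b u w →
        (Dₚ x y :* Dₚ x y :* Aₚ x y) :* ((x :* b) :* u :+ w)
          := w :* (Qₚ x y :* Dₚ x y)
             :+ (b :* x :* x :* x :- (1ₚ :+ 1ₚ) :* b :* x :* x :* y :+ b :* x :* y :* y)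
                :* (u :* Aₚ x y :- y :* w)
             :+ (w :* x :* x :* y :- w :* x :* y :* y) :* fibreₚ x y b)
      refl x y b u w)

  C-identity : ∀ {b} → Fibre b → C * b ≡ (1# - y) * (1# - y)
  C-identity {b} fib = modulo₁ (1# - y) fib
    (solve 3 (λ x y b → Cₚ x y :* b := (1ₚ :- y) :* (1ₚ :- y) :+ (1ₚ :- y) :* fibreₚ x y b)
      refl x y b)

  yC-identity : y * C ≡ ((1# - y) * x) * ((1# - y) * x) - (1# - y) * Q
  yC-identity = solve 2 (λ x y →
    y :* Cₚ x y := ((1ₚ :- y) :* x) :* ((1ₚ :- y) :* x) :- (1ₚ :- y) :* Qₚ x y) refl x y

  module WhenInS (xy∈S : InS x y) where

    D≢0 : D ≢ 0#
    D≢0 = let (_ , _ , x≢y , _) = xy∈S in x≢y⇒x-y≢0 x≢y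

    private
      x□ : IsSquare x
      x□ = let (x□ , _) = xy∈S in x□
      y□ : IsSquare y
      y□ = let (_ , y□ , _) = xy∈S in y□
      x≢0 : x ≢ 0#
      x≢0 = let (_ , _ , _ , x≢0 , _) = xy∈S in x≢0
      x≢1 : x ≢ 1#
      x≢1 = let (_ , _ , _ , _ , x≢1 , _) = xy∈S in x≢1
      y≢0 : y ≢ 0#
      y≢0 = let (_ , _ , _ , _ , _ , y≢0 , _) = xy∈S in y≢0
      1-y≢0 : 1# - y ≢ 0#
      1-y≢0 = let (_ , _ , _ , _ , _ , _ , y≢1) = xy∈S in x≢y⇒x-y≢0 (y≢1 ∘ sym)

    fibre-b≢0 : ∀ {b} → Fibre b → b ≢ 0#
    fibre-b≢0 fib refl = 1-y≢0 (trans (sym fib) (solve 1 (λ D → 0ₚ :* D := 0ₚ) refl D))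

    fibre-1-b≢0 : ∀ {b} → Fibre b → 1# - b ≢ 0#
    fibre-1-b≢0 fib 1-b≡0 = x≢y⇒x-y≢0 x≢1 (begin
      x - 1#        ≡⟨ D*[1-b]≡x-1 fib ⟨
      D * (1# - _)  ≡⟨ cong (D *_) 1-b≡0 ⟩
      D * 0#        ≡⟨ zeroʳ D ⟩
      0#            ∎)

    fibre-1-xb : ∀ {b} → Fibre b → 1# - x * b ≡ y * (1# - b)
    fibre-1-xb {b} = Equivalence.from (≡⇔≡-scaled -1≢0 (Ψ₂-identity b))

    Ψ-fibre : ∀ {a b} → (InΣ a b × Ψ a b ≡ (x , y)) ⇔ (a ≡ x * b × Fibre b)
    Ψ-fibre = mk⇔ to from
      where
      to : ∀ {a b} → InΣ a b × Ψ a b ≡ (x , y) → a ≡ x * b × Fibre b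
      to {b = b} ((_ , _ , _ , b≢0 , b≢1 , _) , Ψab≡xy)
        with p/q≡r⇒p≡r*q b≢0 (cong proj₁ Ψab≡xy)
      ... | refl = refl , Equivalence.to (≡⇔≡-scaled -1≢0 (Ψ₂-identity b))
                            (p/q≡r⇒p≡r*q (x≢y⇒x-y≢0 (b≢1 ∘ sym)) (cong proj₂ Ψab≡xy))
      from : ∀ {a b} → a ≡ x * b × Fibre b → InΣ a b × Ψ a b ≡ (x , y)
      from {b = b} (refl , fib) =
        (a≢b , *-≢0 x≢0 b≢0 , a≢1 , b≢0 , b≢1 , ab□ , [1-a][1-b]□) ,
        cong₂ _,_ (p*q/q≡p b≢0)
                  (trans (cong (_/ (1# - b)) (fibre-1-xb fib)) (p*q/q≡p (fibre-1-b≢0 fib)))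
        where
        b≢0 = fibre-b≢0 fib
        b≢1 : b ≢ 1#
        b≢1 refl = fibre-1-b≢0 fib (solve 0 (1ₚ :- 1ₚ := 0ₚ) refl)
        a≢b : x * b ≢ b
        a≢b xb≡b = x≢1 (*-cancelˡ-≡ b≢0 (begin
          b * x   ≡⟨ *-comm b x ⟩
          x * b   ≡⟨ xb≡b ⟩
          b       ≡⟨ solve 1 (λ b → b := b :* 1ₚ) refl b ⟩
          b * 1#  ∎))
        a≢1 : x * b ≢ 1#
        a≢1 xb≡1 = *-≢0 y≢0 (fibre-1-b≢0 fib) (begin
          y * (1# - b)   ≡⟨ fibre-1-xb fib ⟨
          1# - x * b     ≡⟨ cong (_-_ 1#) xb≡1 ⟩
          1# - 1#        ≡⟨ solve 0 (1ₚ :- 1ₚ := 0ₚ) refl ⟩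
          0#             ∎)
        ab□ : IsSquare (x * b * b)
        ab□ = subst IsSquare (solve 2 (λ x b → x :* (b :* b) := x :* b :* b) refl x b)
                     (square-* x□ (b , refl))
        [1-a][1-b]□ : IsSquare ((1# - x * b) * (1# - b))
        [1-a][1-b]□ = subst IsSquare (begin
          y * ((1# - b) * (1# - b))  ≡⟨ solve 2 (λ y c → y :* (c :* c) := (y :* c) :* c) refl y (1# - b) ⟩
          (y * (1# - b)) * (1# - b)  ≡⟨ cong (_* (1# - b)) (fibre-1-xb fib) ⟨
          (1# - x * b) * (1# - b)    ∎)
          (square-* y□ (1# - b , refl))

    equation⇔uA≡yw : ∀ {b u w} → Fibre b →
      (x * b) * ((x * b) * u + w) ≡ (x * b) * w + b * (u + w - (x * b) * w) ⇔ u * A ≡ y * w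
    equation⇔uA≡yw {u = u} {w} fib =
      ≡⇔≡-scaled (*-≢0 (fibre-b≢0 fib) (fibre-1-b≢0 fib)) (equation-identity u w fib)

    T-square⇔C-square : ∀ {b u w} → Fibre b → u * A ≡ y * w →
      NonzeroSquare A → NonzeroSquare w → IsSquare (u + w - (x * b) * w) ⇔ IsSquare C
    T-square⇔C-square {b} {u} {w} fib uA≡yw A∈□ (w□ , w≢0) =
      ⇔.sym (⇔.trans (square-factors-⇔ Cb∈□) (square-factors-⇔ bT∈□))
      where
      b≢0 = fibre-b≢0 fib
      wya²≢0 : (w * y) * ((x * b) * (x * b)) ≢ 0#
      wya²≢0 = *-≢0 (*-≢0 w≢0 y≢0) (*-≢0 (*-≢0 x≢0 b≢0) (*-≢0 x≢0 b≢0))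
      bT∈□ : NonzeroSquare (b * (u + w - (x * b) * w))
      bT∈□ = square-cancelˡ A∈□ (subst IsSquare (sym (T-identity fib uA≡yw))
                                       (square-* (square-* w□ y□) (x * b , refl)))
           , λ bT≡0 → wya²≢0 (trans (sym (T-identity fib uA≡yw)) (trans (cong (A *_) bT≡0) (zeroʳ A)))
      Cb∈□ : NonzeroSquare (C * b)
      Cb∈□ = subst IsSquare (sym (C-identity fib)) (1# - y , refl)
           , λ Cb≡0 → *-≢0 1-y≢0 1-y≢0 (trans (sym (C-identity fib)) Cb≡0)

    P-square⇔QD-square : ∀ {b u w} → Fibre b → u * A ≡ y * w →
      NonzeroSquare A → NonzeroSquare w → IsSquare ((x * b) * u + w) ⇔ IsSquare (Q * D)
    P-square⇔QD-square fib uA≡yw (A□ , A≢0) w∈□ =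
      square-⇔ (square-* (D , refl) A□ , *-≢0 (*-≢0 D≢0 D≢0) A≢0) w∈□ (P-identity fib uA≡yw)

    E₀₀⁰¹⇒Conditions : ∀ {b u w} → Fibre b → E₀₀⁰¹ (x * b) b u w → Conditions
    E₀₀⁰¹⇒Conditions {u = u} {w} fib E@(u□ , w□ , P□ , T∉□ , equation) = A∈□ , QD∈□ , C∉□
      where
      uA≡yw : u * A ≡ y * w
      uA≡yw = Equivalence.to (equation⇔uA≡yw fib) equation
      w∈□ : NonzeroSquare w
      w∈□ = w□ , E₀₀⁰¹⇒w≢0 E
      uA≢0 : u * A ≢ 0#
      uA≢0 uA≡0 = *-≢0 y≢0 (E₀₀⁰¹⇒w≢0 E) (trans (sym uA≡yw) uA≡0)
      u≢0 : u ≢ 0#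
      u≢0 refl = uA≢0 (solve 1 (λ A → 0ₚ :* A := 0ₚ) refl A)
      A∈□ : NonzeroSquare A
      A∈□ = Equivalence.from (square-⇔ (u□ , u≢0) (y□ , y≢0) uA≡yw) w□
          , λ A≡0 → uA≢0 (trans (cong (u *_) A≡0) (zeroʳ u))
      C∉□ : ¬ IsSquare C
      C∉□ = T∉□ ∘ Equivalence.from (T-square⇔C-square fib uA≡yw A∈□ w∈□)
      Q≢0 : Q ≢ 0#
      Q≢0 Q≡0 = C∉□ (square-cancelˡ (y□ , y≢0) (subst IsSquare (sym yC≡X²) (X , refl)))
        where
        X = (1# - y) * x
        yC≡X² : y * C ≡ X * X
        yC≡X² = begin
          y * C                   ≡⟨ yC-identity ⟩
          X * X - (1# - y) * Q    ≡⟨ cong (λ q → X * X - (1# - y) * q) Q≡0 ⟩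
          X * X - (1# - y) * 0#   ≡⟨ solve 2 (λ X c → X :- c :* 0ₚ := X) refl (X * X) (1# - y) ⟩
          X * X                   ∎
      QD∈□ : NonzeroSquare (Q * D)
      QD∈□ = Equivalence.to (P-square⇔QD-square fib uA≡yw A∈□ w∈□) P□ , *-≢0 Q≢0 D≢0

    Conditions⇒E₀₀⁰¹ : ∀ {b} → Fibre b → Conditions → E₀₀⁰¹ (x * b) b (y * A) (A * A)
    Conditions⇒E₀₀⁰¹ fib (A∈□@(A□ , A≢0) , (QD□ , _) , C∉□) =
      square-* y□ A□ , (A , refl) ,
      Equivalence.from (P-square⇔QD-square fib uA≡yw A∈□ A²∈□) QD□ ,
      C∉□ ∘ Equivalence.to (T-square⇔C-square fib uA≡yw A∈□ A²∈□) ,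
      Equivalence.from (equation⇔uA≡yw fib) uA≡yw
      where
      uA≡yw : y * A * A ≡ y * (A * A)
      uA≡yw = solve 2 (λ y A → y :* A :* A := y :* (A :* A)) refl y A
      A²∈□ : NonzeroSquare (A * A)
      A²∈□ = (A , refl) , *-≢0 A≢0 A≢0

lemma2p6 : (F : FiniteField) → let open FiniteField F in
    IsPrimePower card → ¬ (2 ∣ card) →
    ∀ x y → InS x y →
    (InS' zero zero zero (suc zero) x y
    ⇔ (NonzeroSquare (- (x * y) - y + x)
    × NonzeroSquare ((- (x * x * y) + x * x + y * y - x * y) * (x - y))
    × ¬ IsSquare ((1# - y) * (x - y))))
lemma2p6 F _ _ x y xy∈S = mk⇔ forward backward
  where
  open FiniteFieldProperties F
  open AtPoint F x y
  open WhenInS xy∈S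

  forward : InS' zero zero zero (suc zero) x y → Conditions
  forward (a , b , (σ , u , v , uv∈E) , Ψab≡xy) with Equivalence.to Ψ-fibre (σ , Ψab≡xy)
  ... | refl , fib = E₀₀⁰¹⇒Conditions fib (Equivalence.to InE′⇔E₀₀⁰¹ uv∈E)

  backward : Conditions → InS' zero zero zero (suc zero) x y
  backward conditions =
    x * b , b , (proj₁ fibre , y * A , - (A * A) , uv∈E) , proj₂ fibre
    where
    b = (1# - y) / D
    fib : Fibre b
    fib = p/q*q≡p D≢0
    fibre = Equivalence.from Ψ-fibre (refl , fib)
    uv∈E = Equivalence.from InE′⇔E₀₀⁰¹
      (subst (E₀₀⁰¹ (x * b) b (y * A)) (sym (-‿involutive (A * A))) (Conditions⇒E₀₀⁰¹ fib conditions))
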